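{- Consider the synchronous circuit with bit-valued registers $R$, $RH$, $S_0,S_1,S_2,S_3$ (arbitrary initial values), a bit input $\mathrm{inp}$, and a combinational output $v$, whose behavior at each cycle $T\in\mathbb{N}$ is: $R^{T+1}=\mathrm{inp}^T$, $RH^{T+1}=R^T$, $S_0^{T+1}=RH^T$, $S_i^{T+1}=S_{i-1}^T$ for $i=1,2,3$, and $v^T=\mathrm{maj}(RH^T,S_0^T,S_1^T,S_2^T,S_3^T)$, where $\mathrm{maj}$ is the majority of five bits. Then for every input sequence, every initial state, every position $t\in\mathbb{N}$ and every bit $b\in\{0,1\}$: if $\mathrm{inp}^{t+x}=b$ for all $x\in\{0,\dots,6\}$, then $v^{t+x}=b$ for all $x\in\{4,\dots,10\}$.
   Context: This is the input stage (two-register synchronizer followed by a 4-bit shift register and a 5-input majority vote) of the receiver of a FlexRay-like bit-clock synchronization interface; $s^T$ denotes the value of signal $s$ at hardware cycle $T$. In temporal-logic form the claim is that the property "$\bigwedge_{x=0}^{6}X^x(\mathrm{inp}=b)\Rightarrow\bigwedge_{x=4}^{10}X^x(v=b)$" holds globally (at every position of every trace) of the circuit's Kripke structure with unconstrained initial states, where $X$ is the LTL next operator. -}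

module Defs where

open import Data.Bool using (Bool; true; false)
open import Data.Nat using (ℕ; zero; suc; _+_; _≤_; _≤ᵇ_)

record State : Set where
  constructor mkState
  field
    R RH S0 S1 S2 S3 : Bool
open State public

bitVal : Bool → ℕ
bitVal true  = 1
bitVal false = 0

maj5 : Bool → Bool → Bool → Bool → Bool → Bool
maj5 a b c d e = 3 ≤ᵇ (bitVal a + bitVal b + bitVal c + bitVal d + bitVal e)

step : Bool → State → State
step i s = mkState i (R s) (RH s) (S0 s) (S1 s) (S2 s)

state : (ℕ → Bool) → State → ℕ → State
state inp s0 zero    = s0
state inp s0 (suc T) = step (inp T) (state inp s0 T)

v : (ℕ → Bool) → State → ℕ → Bool
v inp s0 T = let s = state inp s0 T in maj5 (RH s) (S0 s) (S1 s) (S2 s) (S3 s)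

module Submission where

-- The registers RH, S0, S1, S2, S3 form a delay line, so at time
-- T the output v is the majority of (up to) the inputs at times T-2, ..., T-6;
-- taps reaching back before time 0 still hold the arbitrary initial state.
-- A majority of five bits is decided by any three of them that agree, and the
-- three "fresh" taps lie in the first, middle or last position of the window.
-- Hence a run of three equal inputs starting at time n forces v = b at times
-- n+4 (first three taps), n+5 (middle three) and n+6 (last three).

open import Defs
open import Data.Bool using (Bool; true; false; T)
open import Data.Nat using (ℕ; suc; _+_; _≤_; _≤ᵇ_; s≤s)
open import Data.Nat.Properties using (<⇒≤; ≤ᵇ⇒≤; +-commutativeSemigroup)
open import Data.Nat.Tactic.RingSolver using (solve-∀)
open import Data.Product using (_×_; _,_; proj₁; proj₂)
open import Relation.Binary.PropositionalEquality
  using (_≡_; refl; trans; cong; subst)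
open import Algebra.Properties.CommutativeSemigroup +-commutativeSemigroup
  using (x∙yz≈y∙xz)

-- The majority only depends on the number of true arguments, so it is
-- invariant under rotating its arguments.
maj5-rotate : ∀ a b c d e → maj5 a b c d e ≡ maj5 b c d e a
maj5-rotate a b c d e =
  cong (3 ≤ᵇ_) (sum-rotate (bitVal a) (bitVal b) (bitVal c) (bitVal d) (bitVal e))
  where
  sum-rotate : ∀ a b c d e → a + b + c + d + e ≡ b + c + d + e + a
  sum-rotate = solve-∀

maj5-first-three : ∀ {b x₁ x₂ x₃} x₄ x₅ →
  x₁ ≡ b → x₂ ≡ b → x₃ ≡ b → maj5 x₁ x₂ x₃ x₄ x₅ ≡ b
maj5-first-three {true}  true  true  refl refl refl = refl
maj5-first-three {true}  true  false refl refl refl = refl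
maj5-first-three {true}  false true  refl refl refl = refl
maj5-first-three {true}  false false refl refl refl = refl
maj5-first-three {false} true  true  refl refl refl = refl
maj5-first-three {false} true  false refl refl refl = refl
maj5-first-three {false} false true  refl refl refl = refl
maj5-first-three {false} false false refl refl refl = refl

maj5-middle-three : ∀ {b x₂ x₃ x₄} x₁ x₅ →
  x₂ ≡ b → x₃ ≡ b → x₄ ≡ b → maj5 x₁ x₂ x₃ x₄ x₅ ≡ b
maj5-middle-three {x₂ = x₂} {x₃} {x₄} x₁ x₅ p₂ p₃ p₄ =
  trans (maj5-rotate x₁ x₂ x₃ x₄ x₅) (maj5-first-three x₅ x₁ p₂ p₃ p₄)

maj5-last-three : ∀ {b x₃ x₄ x₅} x₁ x₂ →
  x₃ ≡ b → x₄ ≡ b → x₅ ≡ b → maj5 x₁ x₂ x₃ x₄ x₅ ≡ b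
maj5-last-three {x₃ = x₃} {x₄} {x₅} x₁ x₂ p₃ p₄ p₅ =
  trans (maj5-rotate x₁ x₂ x₃ x₄ x₅) (maj5-middle-three x₂ x₁ p₃ p₄ p₅)

module DelayLine (inp : ℕ → Bool) (s₀ : State) where

  RH-delay : ∀ n → RH (state inp s₀ (2 + n)) ≡ inp n
  RH-delay n = refl

  S0-delay : ∀ n → S0 (state inp s₀ (3 + n)) ≡ inp n
  S0-delay n = refl

  S1-delay : ∀ n → S1 (state inp s₀ (4 + n)) ≡ inp n
  S1-delay n = refl

  S2-delay : ∀ n → S2 (state inp s₀ (5 + n)) ≡ inp n
  S2-delay n = refl

  S3-delay : ∀ n → S3 (state inp s₀ (6 + n)) ≡ inp n
  S3-delay n = refl

  Run3 : ℕ → Bool → Set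
  Run3 n b = inp n ≡ b × inp (1 + n) ≡ b × inp (2 + n) ≡ b

  run⇒output : ∀ {n b} → Run3 n b →
    v inp s₀ (4 + n) ≡ b × v inp s₀ (5 + n) ≡ b × v inp s₀ (6 + n) ≡ b
  run⇒output {n} (r₀ , r₁ , r₂) =
      maj5-first-three (S2 s₄) (S3 s₄)
        (trans (RH-delay (2 + n)) r₂) (trans (S0-delay (1 + n)) r₁) (trans (S1-delay n) r₀)
    , maj5-middle-three (RH s₅) (S3 s₅)
        (trans (S0-delay (2 + n)) r₂) (trans (S1-delay (1 + n)) r₁) (trans (S2-delay n) r₀)
    , maj5-last-three (RH s₆) (S0 s₆)
        (trans (S1-delay (2 + n)) r₂) (trans (S2-delay (1 + n)) r₁) (trans (S3-delay n) r₀)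
    where
    s₄ s₅ s₆ : State
    s₄ = state inp s₀ (4 + n)
    s₅ = state inp s₀ (5 + n)
    s₆ = state inp s₀ (6 + n)

  sub-run : ∀ {t L b} → (∀ x → x ≤ L → inp (t + x) ≡ b) →
    ∀ j → 2 + j ≤ L → Run3 (t + j) b
  sub-run {t} h j 2+j≤L =
      h j (<⇒≤ (<⇒≤ 2+j≤L))
    , trans (cong inp (x∙yz≈y∙xz 1 t j)) (h (1 + j) (<⇒≤ 2+j≤L))
    , trans (cong inp (x∙yz≈y∙xz 2 t j)) (h (2 + j) 2+j≤L)

proposition7 : (inp : ℕ → Bool) (s0 : State) (t : ℕ) (b : Bool) →
    (∀ x → x ≤ 6 → inp (t + x) ≡ b) →
    ∀ x → 4 ≤ x → x ≤ 10 → v inp s0 (t + x) ≡ b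
proposition7 inp s0 t b h = cover
  where
  open DelayLine inp s0

  output-after : ∀ j → {T (2 + j ≤ᵇ 6)} →
    v inp s0 (4 + (t + j)) ≡ b × v inp s0 (5 + (t + j)) ≡ b × v inp s0 (6 + (t + j)) ≡ b
  output-after j {bounded} = run⇒output (sub-run h j (≤ᵇ⇒≤ (2 + j) 6 bounded))

  at : ∀ k j → v inp s0 (k + (t + j)) ≡ b → v inp s0 (t + (k + j)) ≡ b
  at k j = subst (λ time → v inp s0 time ≡ b) (x∙yz≈y∙xz k t j)

  cover : ∀ x → 4 ≤ x → x ≤ 10 → v inp s0 (t + x) ≡ b
  cover 4  _ _ = at 4 0 (proj₁ (output-after 0))
  cover 5  _ _ = at 5 0 (proj₁ (proj₂ (output-after 0)))
  cover 6  _ _ = at 6 0 (proj₂ (proj₂ (output-after 0)))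
  cover 7  _ _ = at 6 1 (proj₂ (proj₂ (output-after 1)))
  cover 8  _ _ = at 6 2 (proj₂ (proj₂ (output-after 2)))
  cover 9  _ _ = at 6 3 (proj₂ (proj₂ (output-after 3)))
  cover 10 _ _ = at 6 4 (proj₂ (proj₂ (output-after 4)))
  cover 0  () _
  cover 1  (s≤s ()) _
  cover 2  (s≤s (s≤s ())) _
  cover 3  (s≤s (s≤s (s≤s ()))) _
  cover (suc (suc (suc (suc (suc (suc (suc (suc (suc (suc (suc _)))))))))))
    _ (s≤s (s≤s (s≤s (s≤s (s≤s (s≤s (s≤s (s≤s (s≤s (s≤s ()))))))))))
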